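{- For all integers $u \geq 1$ and $n \geq 1$ we have \begin{align*} \widehat{F}(k^un;x) &= \widehat{M}(n; x^{k^u}) \widehat{F}(k^u;x), \\ \widehat{F}^R(k^un;x) &= \widehat{M}^R(k^u;x) \widehat{F}^R(n;x^{k^u}). \end{align*}
   Context: Let $k \geq 2$, $\Sigma_k = \{0,\ldots,k-1\}$, $\Sigma_k^t$ the words of length $t$ over $\Sigma_k$, $[w]_k$ the integer represented in base $k$ by $w$ (leading zeros allowed), $w^R$ the reversal of $w$. Let $\mathcal{A} = (Q,\Sigma_k,\delta,q_0,\Delta,\tau)$ be a deterministic finite automaton with output, $Q = \{q_0, \ldots, q_{d-1}\}$, $\delta$ extended to words by $\delta(q,\epsilon)=q$, $\delta(q,wa)=\delta(\delta(q,w),a)$, output function $\tau\colon Q\to \Delta\subset\mathbb{C}$. Let $f_i(w) = \tau(\delta(q_i,w))$. Let $M(x)=[m_{ij}(x)]$ with $m_{ij}(x) = \sum_{a \in \Sigma_k,\ \delta(q_i,a)=q_j} x^a$. Assume (after renumbering states other than $q_0$) that $\{f_0,\ldots,f_c\}$ spans $\operatorname{span}_{\mathbb{C}}\{f_0,\ldots,f_{d-1}\}$, and for $c<p\le d-1$ write $f_p=\sum_{j=0}^c \alpha_{pj} f_j$ with $\alpha_{pj}\in\mathbb{C}$. Define the $(c+1)\times(c+1)$ matrix $\widehat{M}(x) = [\widehat{m}_{ij}(x)]_{0\le i,j\le c}$ by $\widehat{m}_{ij}(x) = m_{ij}(x) + \sum_{p=c+1}^{d-1}\alpha_{pj} m_{ip}(x)$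 (so $\widehat M = M$ if $c=d-1$). For $t\ge 0$ put $\widehat{M}(k^t;x) = \widehat{M}(x^{k^{t-1}}) \cdots \widehat{M}(x^{k}) \widehat{M}(x)$ and $\widehat{M}^{R}(k^t;x) = \widehat{M}(x) \widehat{M}(x^{k})\cdots \widehat{M}(x^{k^{t-1}})$. For integers $n\ge1$ and $t$ with $k^{t-1}+1 \le n \le k^t$, writing $\widehat{M}(k^t;x)=\sum_{m=0}^{k^t-1}\widehat{M}_m x^m$, define $\widehat{M}(n;x) = \sum_{m=0}^{n-1}\widehat{M}_m x^m$, and define $F_i(n;x) = \sum_{w \in \Sigma_k^{t},\ [w]_k \le n-1} f_i(w) x^{[w]_k}$ and $F_i^R(n;x) = \sum_{w \in \Sigma_k^{t},\ [w]_k \le n-1} f_i(w^R) x^{[w]_k}$. Let $\widehat{F}(n;x) = [F_0(n;x), \ldots, F_{c}(n;x)]^T$ and $\widehat{F}^R(n;x) = [F^R_0(n;x), \ldots, F^R_{c}(n;x)]^T$. -}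

module Defs where

open import Level using (Level)
open import Algebra.Bundles using (CommutativeRing)
open import Data.Nat using (ℕ; zero; suc; _+_; _*_; _∸_; _^_; _<_; _≤_; _≡ᵇ_; _<ᵇ_)
open import Data.Fin using (Fin; toℕ; _↑ˡ_; _↑ʳ_)
import Data.Fin as Fin
open import Data.Fin.Properties using (_≟_)
open import Data.Bool using (if_then_else_)
open import Data.List using (List; []; _∷_; foldl; reverse)
open import Data.Vec using (Vec)
import Data.Vec as V
open import Data.Product using (_×_)
open import Relation.Nullary using (does)

-- "k^(t-1) < n ≤ k^t" (the length t of the words used for F(n;x), M(n;x)),
-- written without negative exponents: k^t < k*n and n ≤ k^t.
LenFor : ℕ → ℕ → ℕ → Set
LenFor k n t = (k ^ t < k * n) × (n ≤ k ^ t)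

-- Everything is over an arbitrary commutative ring R (playing the role of ℂ).
module Series {a ℓ : Level} (R : CommutativeRing a ℓ) where
  open CommutativeRing R renaming (_+_ to _⊕_; _*_ to _⊗_)

  sumℕ : ℕ → (ℕ → Carrier) → Carrier
  sumℕ zero    f = 0#
  sumℕ (suc n) f = sumℕ n f ⊕ f n

  sumFin : ∀ {n} → (Fin n → Carrier) → Carrier
  sumFin {zero}  f = 0#
  sumFin {suc n} f = f Fin.zero ⊕ sumFin (λ i → f (Fin.suc i))

  -- formal power series in x, given by their coefficient sequence
  -- (all series occurring below are polynomials)
  Ser : Set a
  Ser = ℕ → Carrier

  _≈S_ : Ser → Ser → Set ℓ
  p ≈S q = ∀ m → p m ≈ q m

  0S : Ser
  0S m = 0#

  mono : ℕ → Ser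
  mono e m = if m ≡ᵇ e then 1# else 0#

  _+S_ : Ser → Ser → Ser
  (p +S q) m = p m ⊕ q m

  _*S_ : Ser → Ser → Ser
  (p *S q) m = sumℕ (suc m) (λ i → p i ⊗ q (m ∸ i))

  scale : Carrier → Ser → Ser
  scale r p m = r ⊗ p m

  sumFinS : ∀ {n} → (Fin n → Ser) → Ser
  sumFinS f m = sumFin (λ i → f i m)

  -- substitution x ↦ x^K :  p(x^K)
  subS : ℕ → Ser → Ser
  subS K p m = sumℕ (suc m) (λ i → if i * K ≡ᵇ m then p i else 0#)

  trunc : ℕ → Ser → Ser
  trunc n p m = if m <ᵇ n then p m else 0#

  Mat : ℕ → ℕ → Set a
  Mat r s = Fin r → Fin s → Ser

  VecS : ℕ → Set a
  VecS r = Fin r → Ser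

  _·M_ : ∀ {r s t} → Mat r s → Mat s t → Mat r t
  (A ·M B) i j = sumFinS (λ l → A i l *S B l j)

  _·V_ : ∀ {r s} → Mat r s → VecS s → VecS r
  (A ·V v) i = sumFinS (λ l → A i l *S v l)

  idM : ∀ {r} → Mat r r
  idM i j = if does (i ≟ j) then mono 0 else 0S

  subM : ∀ {r s} → ℕ → Mat r s → Mat r s
  subM K A i j = subS K (A i j)

  truncM : ∀ {r s} → ℕ → Mat r s → Mat r s
  truncM n A i j = trunc n (A i j)

-- The automaton: states Fin (suc c + e); states j ↑ˡ e (j : Fin (suc c))
-- are q_0,…,q_c (the spanning ones), suc c ↑ʳ p are q_{c+1},…,q_{d-1};
-- q_0 = zero ↑ˡ e.
module Automaton {a ℓ : Level} (R : CommutativeRing a ℓ) (k : ℕ) {c e : ℕ}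
    (δ : Fin (suc c + e) → Fin k → Fin (suc c + e))
    (τ : Fin (suc c + e) → CommutativeRing.Carrier R)
    (α : Fin e → Fin (suc c) → CommutativeRing.Carrier R) where
  open CommutativeRing R renaming (_+_ to _⊕_; _*_ to _⊗_)
  open Series R

  State : Set
  State = Fin (suc c + e)

  δ* : State → List (Fin k) → State
  δ* q []      = q
  δ* q (b ∷ w) = δ* (δ q b) w

  f : State → List (Fin k) → Carrier
  f q w = τ (δ* q w)

  -- [w]_k, most significant digit first
  val : List (Fin k) → ℕ
  val = foldl (λ acc b → acc * k + toℕ b) 0

  bas : Fin (suc c) → State
  bas j = j ↑ˡ e

  ext : Fin e → State
  ext p = suc c ↑ʳ p

  LinRel : Set ℓ
  LinRel = ∀ (p : Fin e) (w : List (Fin k)) →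
             f (ext p) w ≈ sumFin (λ j → α p j ⊗ f (bas j) w)

  mM : State → State → Ser
  mM i j = sumFinS (λ (b : Fin k) → if does (δ i b ≟ j) then mono (toℕ b) else 0S)

  Mhat : Mat (suc c) (suc c)
  Mhat i j = mM (bas i) (bas j) +S sumFinS (λ p → scale (α p j) (mM (bas i) (ext p)))

  -- \hat M(k^t;x) = \hat M(x^{k^{t-1}}) ⋯ \hat M(x)
  MhatPow : ℕ → Mat (suc c) (suc c)
  MhatPow zero    = idM
  MhatPow (suc t) = subM (k ^ t) Mhat ·M MhatPow t

  -- \hat M^R(k^t;x) = \hat M(x) ⋯ \hat M(x^{k^{t-1}})
  MhatPowR : ℕ → Mat (suc c) (suc c)
  MhatPowR zero    = idM
  MhatPowR (suc t) = MhatPowR t ·M subM (k ^ t) Mhat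

  -- \hat M(n;x), where t is the length with LenFor k n t
  MhatN : ℕ → ℕ → Mat (suc c) (suc c)
  MhatN t n = truncM n (MhatPow t)

  sumWords : (t : ℕ) → (Vec (Fin k) t → Ser) → Ser
  sumWords zero    g = g V.[]
  sumWords (suc t) g = sumFinS (λ b → sumWords t (λ w → g (b V.∷ w)))

  -- F_i(n;x) = Σ_{w ∈ Σ_k^t, [w]_k ≤ n-1} f_i(w) x^{[w]_k}   (t with LenFor k n t)
  Fhat : ℕ → ℕ → VecS (suc c)
  Fhat t n i = sumWords t (λ w →
    if val (V.toList w) <ᵇ n
    then scale (f (bas i) (V.toList w)) (mono (val (V.toList w)))
    else 0S)

  -- F^R_i(n;x) = Σ_{w ∈ Σ_k^t, [w]_k ≤ n-1} f_i(w^R) x^{[w]_k}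
  FhatR : ℕ → ℕ → VecS (suc c)
  FhatR t n i = sumWords t (λ w →
    if val (V.toList w) <ᵇ n
    then scale (f (bas i) (reverse (V.toList w))) (mono (val (V.toList w)))
    else 0S)

-- Let C(w) be the matrix with f_i(w ++ y) = Σ_j C(w)_ij f_j(y) (it exists because f_0,…,f_c span
-- the f_q, and C(xs ++ ys) = C(xs) C(ys)).  Expanding the products, M̂(k^t;x) = Σ_{|w|=t} C(w) x^[w]
-- and M̂^R(k^t;x) = Σ_{|w|=t} C(w^R) x^[w].  A word of length u + t is v w with |v| = t, |w| = u and
-- [v w] = [v] k^u + [w] with [w] < k^u, so [v w] < k^u n iff [v] < n.  Writing f_i(v w) =
-- Σ_j C(v)_ij f_j(w), resp. f_i((v w)^R) = Σ_j C(w^R)_ij f_j(v^R), the truncated double sum over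
-- (v, w) factors into the two matrix products.

module Submission where

open import Algebra.Bundles using (CommutativeRing)
import Algebra.Properties.CommutativeSemigroup as CommutativeSemigroupProperties
open import Data.Bool using (true; false; if_then_else_)
open import Data.Fin using (Fin; zero; suc; toℕ; splitAt)
open import Data.Fin.Properties using (_≟_; ↑ˡ-injective; ↑ʳ-injective; splitAt-↑ˡ; splitAt-↑ʳ;
  splitAt⁻¹-↑ˡ; splitAt⁻¹-↑ʳ; toℕ<n)
open import Data.List using (List; []; _∷_; _++_; foldl; reverse; length)
open import Data.List.Properties using (foldl-++; unfold-reverse; reverse-++)
open import Data.Nat using (ℕ; zero; suc; _+_; _*_; _∸_; _^_; _<_; _≤_; _≡ᵇ_; _<ᵇ_; z≤n; s≤s;
  NonZero; >-nonZero)
open import Data.Nat.Properties using (≤-trans; ≰⇒>; m≤m+n; +-monoʳ-<;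
  *-monoˡ-≤; *-cancelʳ-<; m+n∸m≡n; m+[n∸m]≡n; m^n>0; <ᵇ-reflects-<; <ᵇ⇒<; <⇒<ᵇ;
  module ≤-Reasoning)
import Data.Nat.Properties as ℕ
open import Data.Nat.Solver using (module +-*-Solver)
open import Data.Product using (_×_; _,_)
open import Data.Sum using (inj₁; inj₂)
open import Data.Vec using (Vec; []; _∷_; toList)
open import Data.Vec.Properties using (length-toList)
open import Defs
open import Function using (_∘_)
open import Level using (Level)
open import Relation.Binary.Bundles using (Setoid)
import Relation.Binary.Reasoning.Setoid as SetoidReasoning
open import Relation.Binary.PropositionalEquality as ≡ using (_≡_; _≢_)
open import Relation.Nullary using (does; yes; no)
open import Relation.Nullary.Decidable using (dec-true; dec-false)
open import Relation.Nullary.Reflects using (det; fromEquivalence; ofʸ)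

module FiniteSums {a ℓ : Level} (R : CommutativeRing a ℓ) where
  open CommutativeRing R hiding (zero) renaming (_+_ to _⊕_; _*_ to _⊗_)
  open Series R using (sumFin; sumℕ)
  open CommutativeSemigroupProperties +-commutativeSemigroup using (interchange)
  open SetoidReasoning setoid

  sumFin-cong : ∀ {n} {f g : Fin n → Carrier} → (∀ i → f i ≈ g i) → sumFin f ≈ sumFin g
  sumFin-cong {zero}  f≈g = refl
  sumFin-cong {suc n} f≈g = +-cong (f≈g zero) (sumFin-cong (f≈g ∘ suc))

  sumFin-zero : ∀ {n} {f : Fin n → Carrier} → (∀ i → f i ≈ 0#) → sumFin f ≈ 0#
  sumFin-zero {zero}  f≈0 = refl
  sumFin-zero {suc n} f≈0 = trans (+-cong (f≈0 zero) (sumFin-zero (f≈0 ∘ suc))) (+-identityˡ 0#)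

  sumFin-distrib-⊕ : ∀ {n} (f g : Fin n → Carrier) →
    sumFin (λ i → f i ⊕ g i) ≈ sumFin f ⊕ sumFin g
  sumFin-distrib-⊕ {zero}  f g = sym (+-identityˡ 0#)
  sumFin-distrib-⊕ {suc n} f g =
    trans (+-congˡ (sumFin-distrib-⊕ (f ∘ suc) (g ∘ suc))) (interchange _ _ _ _)

  ⊗-distribˡ-sumFin : ∀ {n} r (f : Fin n → Carrier) → r ⊗ sumFin f ≈ sumFin (λ i → r ⊗ f i)
  ⊗-distribˡ-sumFin {zero}  r f = zeroʳ r
  ⊗-distribˡ-sumFin {suc n} r f = trans (distribˡ r _ _) (+-congˡ (⊗-distribˡ-sumFin r (f ∘ suc)))

  ⊗-distribʳ-sumFin : ∀ {n} r (f : Fin n → Carrier) → sumFin f ⊗ r ≈ sumFin (λ i → f i ⊗ r)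
  ⊗-distribʳ-sumFin {zero}  r f = zeroˡ r
  ⊗-distribʳ-sumFin {suc n} r f = trans (distribʳ r _ _) (+-congˡ (⊗-distribʳ-sumFin r (f ∘ suc)))

  sumFin-comm : ∀ {m n} (f : Fin m → Fin n → Carrier) →
    sumFin (λ i → sumFin (f i)) ≈ sumFin (λ j → sumFin (λ i → f i j))
  sumFin-comm {zero} {n} f = sym (sumFin-zero {n} (λ _ → refl))
  sumFin-comm {suc m} f = trans (+-congˡ (sumFin-comm (f ∘ suc))) (sym (sumFin-distrib-⊕ (f zero) _))

  sumFin-⊗-assoc : ∀ {m n} (A : Fin m → Carrier) (B : Fin m → Fin n → Carrier) (g : Fin n → Carrier) →
    sumFin (λ l → A l ⊗ sumFin (λ j → B l j ⊗ g j)) ≈ sumFin (λ j → sumFin (λ l → A l ⊗ B l j) ⊗ g j)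
  sumFin-⊗-assoc {m} {n} A B g = begin
    sumFin (λ l → A l ⊗ sumFin (λ j → B l j ⊗ g j))
      ≈⟨ sumFin-cong (λ l → ⊗-distribˡ-sumFin (A l) (λ j → B l j ⊗ g j)) ⟩
    sumFin (λ l → sumFin (λ j → A l ⊗ (B l j ⊗ g j)))
      ≈⟨ sumFin-comm (λ l j → A l ⊗ (B l j ⊗ g j)) ⟩
    sumFin (λ j → sumFin (λ l → A l ⊗ (B l j ⊗ g j)))
      ≈⟨ sumFin-cong {n} (λ j → sumFin-cong {m} (λ l → *-assoc _ _ _)) ⟨
    sumFin (λ j → sumFin (λ l → A l ⊗ B l j ⊗ g j))
      ≈⟨ sumFin-cong {n} (λ j → ⊗-distribʳ-sumFin (g j) (λ l → A l ⊗ B l j)) ⟨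
    sumFin (λ j → sumFin (λ l → A l ⊗ B l j) ⊗ g j) ∎

  sumFin-⊕-linear : ∀ {m n} (X : Fin m → Carrier) (α : Fin n → Carrier) (Y : Fin n → Fin m → Carrier)
    (μ : Fin m → Carrier) →
    sumFin (λ b → X b ⊗ μ b) ⊕ sumFin (λ p → α p ⊗ sumFin (λ b → Y p b ⊗ μ b))
      ≈ sumFin (λ b → (X b ⊕ sumFin (λ p → α p ⊗ Y p b)) ⊗ μ b)
  sumFin-⊕-linear X α Y μ = begin
    sumFin (λ b → X b ⊗ μ b) ⊕ sumFin (λ p → α p ⊗ sumFin (λ b → Y p b ⊗ μ b))
      ≈⟨ +-congˡ (sumFin-⊗-assoc α Y μ) ⟩
    sumFin (λ b → X b ⊗ μ b) ⊕ sumFin (λ b → sumFin (λ p → α p ⊗ Y p b) ⊗ μ b)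
      ≈⟨ sumFin-distrib-⊕ (λ b → X b ⊗ μ b) (λ b → sumFin (λ p → α p ⊗ Y p b) ⊗ μ b) ⟨
    sumFin (λ b → X b ⊗ μ b ⊕ sumFin (λ p → α p ⊗ Y p b) ⊗ μ b)
      ≈⟨ sumFin-cong (λ b → distribʳ (μ b) _ _) ⟨
    sumFin (λ b → (X b ⊕ sumFin (λ p → α p ⊗ Y p b)) ⊗ μ b) ∎

  indicator : ∀ {n} → Fin n → Fin n → Carrier
  indicator i j = if does (i ≟ j) then 1# else 0#

  indicator-≢ : ∀ {n} {i j : Fin n} → i ≢ j → indicator i j ≡ 0#
  indicator-≢ {i = i} {j} i≢j = ≡.cong (if_then 1# else 0#) (dec-false (i ≟ j) i≢j)

  indicator-injective : ∀ {m n} (g : Fin m → Fin n) → (∀ {x y} → g x ≡ g y → x ≡ y) →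
    ∀ i j → indicator (g i) (g j) ≡ indicator i j
  indicator-injective g g-inj i j = ≡.cong (if_then 1# else 0#) (does-≡ (i ≟ j))
    where
      does-≡ : ∀ d → does (g i ≟ g j) ≡ does d
      does-≡ (yes i≡j) = dec-true (g i ≟ g j) (≡.cong g i≡j)
      does-≡ (no i≢j)  = dec-false (g i ≟ g j) (i≢j ∘ g-inj)

  sumFin-indicatorˡ : ∀ {n} (i : Fin n) (g : Fin n → Carrier) → sumFin (λ l → indicator i l ⊗ g l) ≈ g i
  sumFin-indicatorˡ {suc n} zero g =
    trans (+-cong (*-identityˡ _) (sumFin-zero {n} (λ _ → zeroˡ _))) (+-identityʳ _)
  sumFin-indicatorˡ (suc i) g = trans (+-cong (zeroˡ _) (sumFin-indicatorˡ i (g ∘ suc))) (+-identityˡ _)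

  sumFin-indicatorʳ : ∀ {n} (j : Fin n) (g : Fin n → Carrier) → sumFin (λ l → g l ⊗ indicator l j) ≈ g j
  sumFin-indicatorʳ {suc n} zero g =
    trans (+-cong (*-identityʳ _) (sumFin-zero {n} (λ _ → zeroʳ _))) (+-identityʳ _)
  sumFin-indicatorʳ (suc j) g = trans (+-cong (zeroʳ _) (sumFin-indicatorʳ j (g ∘ suc))) (+-identityˡ _)

  if-then-cong : ∀ b {x y z} → x ≈ y → (if b then x else z) ≈ (if b then y else z)
  if-then-cong true  x≈y = x≈y
  if-then-cong false x≈y = refl

  if-zero : ∀ b {x} → x ≈ 0# → (if b then x else 0#) ≈ 0#
  if-zero true  x≈0 = x≈0
  if-zero false x≈0 = refl

  if-sumFin : ∀ b {n} (g : Fin n → Carrier) →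
    (if b then sumFin g else 0#) ≈ sumFin (λ j → if b then g j else 0#)
  if-sumFin true  g = refl
  if-sumFin false {n} g = sym (sumFin-zero {n} (λ _ → refl))

  sumFin-gateˡ : ∀ b {n} (A B : Fin n → Carrier) →
    sumFin (λ l → (if b then A l else 0#) ⊗ B l) ≈ (if b then sumFin (λ l → A l ⊗ B l) else 0#)
  sumFin-gateˡ true  A B = refl
  sumFin-gateˡ false {n} A B = sumFin-zero {n} (λ l → zeroˡ (B l))

  sumFin-gateʳ : ∀ b {n} (A B : Fin n → Carrier) →
    sumFin (λ l → A l ⊗ (if b then B l else 0#)) ≈ (if b then sumFin (λ l → A l ⊗ B l) else 0#)
  sumFin-gateʳ true  A B = refl
  sumFin-gateʳ false {n} A B = sumFin-zero {n} (λ l → zeroʳ (A l))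

  sumℕ-cong : ∀ n {f g : ℕ → Carrier} → (∀ i → f i ≈ g i) → sumℕ n f ≈ sumℕ n g
  sumℕ-cong zero    f≈g = refl
  sumℕ-cong (suc n) f≈g = +-cong (sumℕ-cong n f≈g) (f≈g n)

  sumℕ-sumFin-comm : ∀ n {m} (f : ℕ → Fin m → Carrier) →
    sumℕ n (λ i → sumFin (f i)) ≈ sumFin (λ j → sumℕ n (λ i → f i j))
  sumℕ-sumFin-comm zero {m} f = sym (sumFin-zero {m} (λ _ → refl))
  sumℕ-sumFin-comm (suc n) f = trans (+-congʳ (sumℕ-sumFin-comm n f)) (sym (sumFin-distrib-⊕ _ (f n)))

  module _ {h : ℕ → Carrier} {s : ℕ} (vanish : ∀ i → i ≢ s → h i ≈ 0#) where

    sumℕ-below-support : ∀ {n} → n ≤ s → sumℕ n h ≈ 0#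
    sumℕ-below-support {zero}  _   = refl
    sumℕ-below-support {suc n} n<s =
      trans (+-cong (sumℕ-below-support (ℕ.<⇒≤ n<s)) (vanish n (λ n≡s → ℕ.<-irrefl n≡s n<s)))
            (+-identityˡ 0#)

    sumℕ-support : ∀ {n} → s < n → sumℕ n h ≈ h s
    sumℕ-support {suc n} (s≤s s≤n) with ℕ.m≤n⇒m<n∨m≡n s≤n
    ... | inj₁ s<n    = trans (+-cong (sumℕ-support s<n) (vanish n (λ n≡s → ℕ.<-irrefl (≡.sym n≡s) s<n)))
                              (+-identityʳ _)
    ... | inj₂ ≡.refl = trans (+-congʳ (sumℕ-below-support ℕ.≤-refl)) (+-identityˡ _)

module PowerSeries {a ℓ : Level} (R : CommutativeRing a ℓ) where
  open CommutativeRing R hiding (zero) renaming (_+_ to _⊕_; _*_ to _⊗_)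
  open Series R
  open FiniteSums R
  open SetoidReasoning setoid

  ≈S-setoid : Setoid a ℓ
  ≈S-setoid = record
    { Carrier       = Ser
    ; _≈_           = _≈S_
    ; isEquivalence = record
      { refl  = λ _ → refl
      ; sym   = λ p≈q m → sym (p≈q m)
      ; trans = λ p≈q q≈r m → trans (p≈q m) (q≈r m)
      }
    }

  open Setoid ≈S-setoid public
    using () renaming (refl to ≈S-refl; sym to ≈S-sym; trans to ≈S-trans; reflexive to ≈S-reflexive)

  infix 30 _·x^_
  _·x^_ : Carrier → ℕ → Ser
  r ·x^ e = scale r (mono e)

  ·x^-diag : ∀ r e → (r ·x^ e) e ≈ r
  ·x^-diag r e = trans (*-congˡ (reflexive (≡.cong (if_then 1# else 0#) (dec-true (e ℕ.≟ e) ≡.refl))))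
                       (*-identityʳ r)

  ·x^-off : ∀ r {e m} → m ≢ e → (r ·x^ e) m ≈ 0#
  ·x^-off r {e} {m} m≢e =
    trans (*-congˡ (reflexive (≡.cong (if_then 1# else 0#) (dec-false (m ℕ.≟ e) m≢e)))) (zeroʳ r)

  ·x^-congˡ : ∀ {r s} e → r ≈ s → r ·x^ e ≈S s ·x^ e
  ·x^-congˡ e r≈s m = *-congʳ r≈s

  ·x^-congʳ : ∀ r {e e′} → e ≡ e′ → r ·x^ e ≈S r ·x^ e′
  ·x^-congʳ r e≡e′ = ≈S-reflexive (≡.cong (r ·x^_) e≡e′)

  if-·x^ : ∀ b r e → (if b then r ·x^ e else 0S) ≈S (if b then r else 0#) ·x^ e
  if-·x^ true  r e m = refl
  if-·x^ false r e m = sym (zeroˡ _)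

  if-mono : ∀ d e m → (if d then mono e else 0S) m ≈ (if d then 1# else 0#) ⊗ mono e m
  if-mono true  e m = sym (*-identityˡ _)
  if-mono false e m = sym (zeroˡ _)

  *S-cong : ∀ {p p′ q q′} → p ≈S p′ → q ≈S q′ → (p *S q) ≈S (p′ *S q′)
  *S-cong p≈p′ q≈q′ m = sumℕ-cong (suc m) (λ i → *-cong (p≈p′ i) (q≈q′ (m ∸ i)))

  subS-cong : ∀ K {p q} → p ≈S q → subS K p ≈S subS K q
  subS-cong K p≈q m = sumℕ-cong (suc m) (λ i → if-then-cong (i * K ≡ᵇ m) (p≈q i))

  trunc-cong : ∀ n {p q} → p ≈S q → trunc n p ≈S trunc n q
  trunc-cong n p≈q m = if-then-cong (m <ᵇ n) (p≈q m)

  ·x^-*S-≥ : ∀ r e p {m} → e ≤ m → (r ·x^ e *S p) m ≈ r ⊗ p (m ∸ e)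
  ·x^-*S-≥ r e p e≤m =
    trans (sumℕ-support (λ i i≢e → trans (*-congʳ (·x^-off r i≢e)) (zeroˡ _)) (s≤s e≤m))
          (*-congʳ (·x^-diag r e))

  ·x^-*S-< : ∀ r e p {m} → m < e → (r ·x^ e *S p) m ≈ 0#
  ·x^-*S-< r e p m<e = sumℕ-below-support (λ i i≢e → trans (*-congʳ (·x^-off r i≢e)) (zeroˡ _)) m<e

  ·x^-*S-·x^ : ∀ r a s b → ((r ·x^ a) *S (s ·x^ b)) ≈S (r ⊗ s) ·x^ (a + b)
  ·x^-*S-·x^ r a s b m with a ℕ.≤? m
  ... | no a≰m = trans (·x^-*S-< r a (s ·x^ b) (≰⇒> a≰m)) (sym (·x^-off (r ⊗ s) m≢a+b))
    where
      m≢a+b : m ≢ a + b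
      m≢a+b m≡a+b = a≰m (≡.subst (a ≤_) (≡.sym m≡a+b) (m≤m+n a b))
  ... | yes a≤m with m ℕ.≟ a + b
  ...   | yes ≡.refl = begin
    ((r ·x^ a) *S (s ·x^ b)) (a + b)  ≈⟨ ·x^-*S-≥ r a (s ·x^ b) a≤m ⟩
    r ⊗ (s ·x^ b) (a + b ∸ a)         ≡⟨ ≡.cong (λ i → r ⊗ (s ·x^ b) i) (m+n∸m≡n a b) ⟩
    r ⊗ (s ·x^ b) b                   ≈⟨ *-congˡ (·x^-diag s b) ⟩
    r ⊗ s                             ≈⟨ ·x^-diag (r ⊗ s) (a + b) ⟨
    ((r ⊗ s) ·x^ (a + b)) (a + b)     ∎
  ...   | no m≢a+b = begin
    ((r ·x^ a) *S (s ·x^ b)) m  ≈⟨ ·x^-*S-≥ r a (s ·x^ b) a≤m ⟩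
    r ⊗ (s ·x^ b) (m ∸ a)       ≈⟨ *-congˡ (·x^-off s m∸a≢b) ⟩
    r ⊗ 0#                      ≈⟨ zeroʳ r ⟩
    0#                          ≈⟨ ·x^-off (r ⊗ s) m≢a+b ⟨
    ((r ⊗ s) ·x^ (a + b)) m     ∎
    where
      m∸a≢b : m ∸ a ≢ b
      m∸a≢b m∸a≡b = m≢a+b (≡.trans (≡.sym (m+[n∸m]≡n a≤m)) (≡.cong (a +_) m∸a≡b))

  subS-·x^ : ∀ K → 1 ≤ K → ∀ r e → subS K (r ·x^ e) ≈S r ·x^ (e * K)
  subS-·x^ K 1≤K r e m with e ℕ.≤? m
  ... | no e≰m = trans (sumℕ-below-support vanish (≰⇒> e≰m))
                       (sym (·x^-off r (λ m≡eK → e≰m (≡.subst (e ≤_) (≡.sym m≡eK) e≤eK))))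
    where
      vanish : ∀ i → i ≢ e → (if i * K ≡ᵇ m then (r ·x^ e) i else 0#) ≈ 0#
      vanish i i≢e = if-zero (i * K ≡ᵇ m) (·x^-off r i≢e)
      e≤eK : e ≤ e * K
      e≤eK = ≡.subst (_≤ e * K) (ℕ.*-identityʳ e) (ℕ.*-monoʳ-≤ e 1≤K)
  ... | yes e≤m = trans (sumℕ-support vanish (s≤s e≤m)) (selected (e * K ℕ.≟ m))
    where
      vanish : ∀ i → i ≢ e → (if i * K ≡ᵇ m then (r ·x^ e) i else 0#) ≈ 0#
      vanish i i≢e = if-zero (i * K ≡ᵇ m) (·x^-off r i≢e)
      selected : ∀ d → (if does d then (r ·x^ e) e else 0#) ≈ (r ·x^ (e * K)) m
      selected (yes ≡.refl) = trans (·x^-diag r e) (sym (·x^-diag r (e * K)))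
      selected (no eK≢m)    = sym (·x^-off r (eK≢m ∘ ≡.sym))

  trunc-·x^ : ∀ n r e → trunc n (r ·x^ e) ≈S (if e <ᵇ n then r else 0#) ·x^ e
  trunc-·x^ n r e m with m ℕ.≟ e
  ... | yes ≡.refl = gate (m <ᵇ n)
    where
      gate : ∀ b → (if b then (r ·x^ m) m else 0#) ≈ (if b then r else 0#) ⊗ mono m m
      gate true  = refl
      gate false = sym (zeroˡ _)
  ... | no m≢e = trans (if-zero (m <ᵇ n) (·x^-off r m≢e)) (sym (·x^-off _ m≢e))

  sumFinS-cong : ∀ {n} {f g : Fin n → Ser} → (∀ i → f i ≈S g i) → sumFinS f ≈S sumFinS g
  sumFinS-cong f≈g m = sumFin-cong (λ i → f≈g i m)

  sumFinS-comm : ∀ {m n} (f : Fin m → Fin n → Ser) →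
    sumFinS (λ i → sumFinS (f i)) ≈S sumFinS (λ j → sumFinS (λ i → f i j))
  sumFinS-comm f m = sumFin-comm (λ i j → f i j m)

  *S-distribˡ-sumFinS : ∀ {n} p (f : Fin n → Ser) → (p *S sumFinS f) ≈S sumFinS (λ i → p *S f i)
  *S-distribˡ-sumFinS p f m = trans (sumℕ-cong (suc m) (λ i → ⊗-distribˡ-sumFin (p i) (λ j → f j (m ∸ i))))
                                    (sumℕ-sumFin-comm (suc m) (λ i j → p i ⊗ f j (m ∸ i)))

  *S-distribʳ-sumFinS : ∀ {n} (f : Fin n → Ser) q → (sumFinS f *S q) ≈S sumFinS (λ i → f i *S q)
  *S-distribʳ-sumFinS f q m = trans (sumℕ-cong (suc m) (λ i → ⊗-distribʳ-sumFin (q (m ∸ i)) (λ j → f j i)))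
                                    (sumℕ-sumFin-comm (suc m) (λ i j → f j i ⊗ q (m ∸ i)))

  subS-sumFinS : ∀ K {n} (f : Fin n → Ser) → subS K (sumFinS f) ≈S sumFinS (λ i → subS K (f i))
  subS-sumFinS K f m = trans (sumℕ-cong (suc m) (λ i → if-sumFin (i * K ≡ᵇ m) (λ j → f j i)))
                             (sumℕ-sumFin-comm (suc m) (λ i j → if i * K ≡ᵇ m then f j i else 0#))

  trunc-sumFinS : ∀ n {n′} (f : Fin n′ → Ser) → trunc n (sumFinS f) ≈S sumFinS (λ i → trunc n (f i))
  trunc-sumFinS n f m = if-sumFin (m <ᵇ n) (λ j → f j m)

  sumFinS-·x^ : ∀ {n} (r : Fin n → Carrier) e → sumFinS (λ i → r i ·x^ e) ≈S sumFin r ·x^ e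
  sumFinS-·x^ r e m = sym (⊗-distribʳ-sumFin (mono e m) r)

<ᵇ-scaled : ∀ {K} v r n → r < K → (v * K + r <ᵇ K * n) ≡ (v <ᵇ n)
<ᵇ-scaled {K} v r n r<K =
  det (<ᵇ-reflects-< (v * K + r) (K * n)) (fromEquivalence (scaled ∘ <ᵇ⇒< v n) (<⇒<ᵇ ∘ unscaled))
  where
    open ≤-Reasoning
    scaled : v < n → v * K + r < K * n
    scaled v<n = begin-strict
      v * K + r  <⟨ +-monoʳ-< (v * K) r<K ⟩
      v * K + K  ≡⟨ ℕ.+-comm (v * K) K ⟩
      suc v * K  ≤⟨ *-monoˡ-≤ K v<n ⟩
      n * K      ≡⟨ ℕ.*-comm n K ⟩
      K * n      ∎
    unscaled : v * K + r < K * n → v < n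
    unscaled vK+r<Kn = *-cancelʳ-< K v n (begin-strict
      v * K      ≤⟨ m≤m+n (v * K) r ⟩
      v * K + r  <⟨ vK+r<Kn ⟩
      K * n      ≡⟨ ℕ.*-comm K n ⟩
      n * K      ∎)

module Digits (k : ℕ) where

  -- definitionally equal to Automaton.val
  value : List (Fin k) → ℕ
  value = foldl (λ acc b → acc * k + toℕ b) 0

  foldl-value : ∀ acc xs → foldl (λ acc b → acc * k + toℕ b) acc xs ≡ acc * k ^ length xs + value xs
  foldl-value acc []       = ≡.sym (≡.trans (ℕ.+-identityʳ _) (ℕ.*-identityʳ acc))
  foldl-value acc (b ∷ xs) = begin
    foldl _ (acc * k + toℕ b) xs                   ≡⟨ foldl-value (acc * k + toℕ b) xs ⟩
    (acc * k + toℕ b) * k ^ length xs + value xs    ≡⟨ regroup acc k (toℕ b) (k ^ length xs) (value xs) ⟩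
    acc * (k * k ^ length xs) + (toℕ b * k ^ length xs + value xs)
      ≡⟨ ≡.cong (acc * (k * k ^ length xs) +_) (foldl-value (toℕ b) xs) ⟨
    acc * (k * k ^ length xs) + value (b ∷ xs)     ∎
    where
      open ≡.≡-Reasoning
      open +-*-Solver
      regroup : ∀ a k d l v → (a * k + d) * l + v ≡ a * (k * l) + (d * l + v)
      regroup = solve 5 (λ a k d l v → (a :* k :+ d) :* l :+ v := a :* (k :* l) :+ (d :* l :+ v)) ≡.refl

  value-++ : ∀ xs ys → value (xs ++ ys) ≡ value xs * k ^ length ys + value ys
  value-++ xs ys = ≡.trans (foldl-++ _ 0 xs ys) (foldl-value (value xs) ys)

  value-< : ∀ xs → value xs < k ^ length xs
  value-< []       = s≤s z≤n
  value-< (b ∷ xs) = begin-strict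
    value (b ∷ xs)               ≡⟨ foldl-value (toℕ b) xs ⟩
    toℕ b * k ^ l + value xs     <⟨ +-monoʳ-< (toℕ b * k ^ l) (value-< xs) ⟩
    toℕ b * k ^ l + k ^ l        ≡⟨ ℕ.+-comm (toℕ b * k ^ l) (k ^ l) ⟩
    suc (toℕ b) * k ^ l          ≤⟨ *-monoˡ-≤ (k ^ l) (toℕ<n b) ⟩
    k ^ suc l                    ∎
    where
      open ≤-Reasoning
      l = length xs

module AutomatonSeries {a ℓ : Level} (R : CommutativeRing a ℓ) {k : ℕ} .{{_ : NonZero k}} {c e : ℕ}
    (δ : Fin (suc c + e) → Fin k → Fin (suc c + e))
    (τ : Fin (suc c + e) → CommutativeRing.Carrier R)
    (α : Fin e → Fin (suc c) → CommutativeRing.Carrier R) where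
  open CommutativeRing R hiding (zero) renaming (_+_ to _⊕_; _*_ to _⊗_)
  open Series R
  open Automaton R k δ τ α
  open FiniteSums R
  open PowerSeries R
  open Digits k

  Word : ℕ → Set
  Word t = Vec (Fin k) t

  ⟦_⟧ : ∀ {t} → Word t → ℕ
  ⟦ w ⟧ = val (toList w)

  ⟦⟧-++ : ∀ {s t} (v : Word s) (w : Word t) → val (toList v ++ toList w) ≡ ⟦ v ⟧ * k ^ t + ⟦ w ⟧
  ⟦⟧-++ v w = ≡.trans (value-++ (toList v) (toList w))
                      (≡.cong (λ l → ⟦ v ⟧ * k ^ l + ⟦ w ⟧) (length-toList w))

  ⟦⟧-< : ∀ {t} (w : Word t) → ⟦ w ⟧ < k ^ t
  ⟦⟧-< w = ≡.subst (λ l → ⟦ w ⟧ < k ^ l) (length-toList w) (value-< (toList w))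

  sumWords-cong : ∀ t {g h : Word t → Ser} → (∀ w → g w ≈S h w) → sumWords t g ≈S sumWords t h
  sumWords-cong zero    g≈h = g≈h []
  sumWords-cong (suc t) g≈h = sumFinS-cong (λ b → sumWords-cong t (g≈h ∘ (b ∷_)))

  commute-sumWords : (φ : Ser → Ser) → (∀ {n} (g : Fin n → Ser) → φ (sumFinS g) ≈S sumFinS (φ ∘ g)) →
    ∀ t (g : Word t → Ser) → φ (sumWords t g) ≈S sumWords t (φ ∘ g)
  commute-sumWords φ φ-sumFinS zero    g = ≈S-refl
  commute-sumWords φ φ-sumFinS (suc t) g =
    ≈S-trans (φ-sumFinS (λ b → sumWords t (g ∘ (b ∷_))))
             (sumFinS-cong (λ b → commute-sumWords φ φ-sumFinS t (g ∘ (b ∷_))))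

  sumFinS-sumWords-comm : ∀ t {n} (g : Fin n → Word t → Ser) →
    sumFinS (λ i → sumWords t (g i)) ≈S sumWords t (λ w → sumFinS (λ i → g i w))
  sumFinS-sumWords-comm zero    g = ≈S-refl
  sumFinS-sumWords-comm (suc t) g =
    ≈S-trans (sumFinS-comm (λ i b → sumWords t (g i ∘ (b ∷_))))
             (sumFinS-cong (λ b → sumFinS-sumWords-comm t (λ i → g i ∘ (b ∷_))))

  sumWords-comm : ∀ s t (g : Word s → Word t → Ser) →
    sumWords s (λ v → sumWords t (g v)) ≈S sumWords t (λ w → sumWords s (λ v → g v w))
  sumWords-comm zero    t g = ≈S-refl
  sumWords-comm (suc s) t g =
    ≈S-trans (sumFinS-cong (λ b → sumWords-comm s t (g ∘ (b ∷_))))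
             (sumFinS-sumWords-comm t (λ b w → sumWords s (λ v → g (b ∷ v) w)))

  sumWords-++ : ∀ s t (h : List (Fin k) → Ser) →
    sumWords (s + t) (h ∘ toList) ≈S sumWords s (λ v → sumWords t (λ w → h (toList v ++ toList w)))
  sumWords-++ zero    t h = ≈S-refl
  sumWords-++ (suc s) t h = sumFinS-cong (λ b → sumWords-++ s t (h ∘ (b ∷_)))

  sumWords-·x^-++ : ∀ s t (φ : List (Fin k) → Carrier) →
    sumWords (s + t) (λ w → φ (toList w) ·x^ ⟦ w ⟧)
      ≈S sumWords s (λ v → sumWords t (λ w → φ (toList v ++ toList w) ·x^ (⟦ v ⟧ * k ^ t + ⟦ w ⟧)))
  sumWords-·x^-++ s t φ =
    ≈S-trans (sumWords-++ s t (λ xs → φ xs ·x^ val xs))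
             (sumWords-cong s (λ v → sumWords-cong t (λ w →
               ·x^-congʳ (φ (toList v ++ toList w)) (⟦⟧-++ v w))))

  subS-sumWords-·x^ : ∀ K → 1 ≤ K → ∀ t (ψ : Word t → Carrier) (ε : Word t → ℕ) →
    subS K (sumWords t (λ w → ψ w ·x^ ε w)) ≈S sumWords t (λ w → ψ w ·x^ (ε w * K))
  subS-sumWords-·x^ K 1≤K t ψ ε =
    ≈S-trans (commute-sumWords (subS K) (subS-sumFinS K) t _)
             (sumWords-cong t (λ w → subS-·x^ K 1≤K (ψ w) (ε w)))

  trunc-sumWords-·x^ : ∀ n t (ψ : Word t → Carrier) (ε : Word t → ℕ) →
    trunc n (sumWords t (λ w → ψ w ·x^ ε w)) ≈S sumWords t (λ w → (if ε w <ᵇ n then ψ w else 0#) ·x^ ε w)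
  trunc-sumWords-·x^ n t ψ ε =
    ≈S-trans (commute-sumWords (trunc n) (trunc-sumFinS n) t _)
             (sumWords-cong t (λ w → trunc-·x^ n (ψ w) (ε w)))

  sumWords-*S-sumWords : ∀ s t (φ : Word s → Carrier) (ε : Word s → ℕ)
    (ψ : Word t → Carrier) (η : Word t → ℕ) →
    (sumWords s (λ v → φ v ·x^ ε v) *S sumWords t (λ w → ψ w ·x^ η w))
      ≈S sumWords s (λ v → sumWords t (λ w → (φ v ⊗ ψ w) ·x^ (ε v + η w)))
  sumWords-*S-sumWords s t φ ε ψ η =
    ≈S-trans (commute-sumWords (_*S Ψ) (λ g → *S-distribʳ-sumFinS g Ψ) s _)
             (sumWords-cong s (λ v →
               ≈S-trans (commute-sumWords ((φ v ·x^ ε v) *S_) (*S-distribˡ-sumFinS _) t _)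
                        (sumWords-cong t (λ w → ·x^-*S-·x^ (φ v) (ε v) (ψ w) (η w)))))
    where
      Ψ : Ser
      Ψ = sumWords t (λ w → ψ w ·x^ η w)

  sumFinS-sumWords-*S-sumWords : ∀ {m} s t (φ : Word s → Fin m → Carrier) (ε : Word s → ℕ)
    (ψ : Word t → Fin m → Carrier) (η : Word t → ℕ) →
    sumFinS (λ l → sumWords s (λ v → φ v l ·x^ ε v) *S sumWords t (λ w → ψ w l ·x^ η w))
      ≈S sumWords s (λ v → sumWords t (λ w → sumFin (λ l → φ v l ⊗ ψ w l) ·x^ (ε v + η w)))
  sumFinS-sumWords-*S-sumWords {m} s t φ ε ψ η = begin
    sumFinS (λ l → sumWords s (λ v → φ v l ·x^ ε v) *S sumWords t (λ w → ψ w l ·x^ η w))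
      ≈⟨ sumFinS-cong (λ l → sumWords-*S-sumWords s t (λ v → φ v l) ε (λ w → ψ w l) η) ⟩
    sumFinS (λ l → sumWords s (λ v → sumWords t (λ w → term l v w)))
      ≈⟨ sumFinS-sumWords-comm s (λ l v → sumWords t (term l v)) ⟩
    sumWords s (λ v → sumFinS (λ l → sumWords t (λ w → term l v w)))
      ≈⟨ sumWords-cong s (λ v → sumFinS-sumWords-comm t (λ l → term l v)) ⟩
    sumWords s (λ v → sumWords t (λ w → sumFinS (λ l → term l v w)))
      ≈⟨ sumWords-cong s (λ v → sumWords-cong t (λ w →
           sumFinS-·x^ (λ l → φ v l ⊗ ψ w l) (ε v + η w))) ⟩
    sumWords s (λ v → sumWords t (λ w → sumFin (λ l → φ v l ⊗ ψ w l) ·x^ (ε v + η w))) ∎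
    where
      open SetoidReasoning ≈S-setoid
      term : Fin m → Word s → Word t → Ser
      term l v w = (φ v l ⊗ ψ w l) ·x^ (ε v + η w)

  truncatedWordSum-split : ∀ u t n (φ : List (Fin k) → Carrier) →
    sumWords (u + t) (λ w → if ⟦ w ⟧ <ᵇ k ^ u * n then φ (toList w) ·x^ ⟦ w ⟧ else 0S)
      ≈S sumWords t (λ v → sumWords u (λ w →
           (if ⟦ v ⟧ <ᵇ n then φ (toList v ++ toList w) else 0#) ·x^ (⟦ v ⟧ * k ^ u + ⟦ w ⟧)))
  truncatedWordSum-split u t n φ rewrite ℕ.+-comm u t =
    ≈S-trans (sumWords-++ t u (λ xs → if val xs <ᵇ k ^ u * n then φ xs ·x^ val xs else 0S))
             (sumWords-cong t (λ v → sumWords-cong u (gate v)))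
    where
      gate : ∀ (v : Word t) (w : Word u) →
        (if val (toList v ++ toList w) <ᵇ k ^ u * n
         then φ (toList v ++ toList w) ·x^ val (toList v ++ toList w) else 0S)
          ≈S (if ⟦ v ⟧ <ᵇ n then φ (toList v ++ toList w) else 0#) ·x^ (⟦ v ⟧ * k ^ u + ⟦ w ⟧)
      gate v w rewrite ⟦⟧-++ v w | <ᵇ-scaled ⟦ v ⟧ ⟦ w ⟧ n (⟦⟧-< w) = if-·x^ (⟦ v ⟧ <ᵇ n) _ _

  bas≢ext : ∀ j p → bas j ≢ ext p
  bas≢ext j p eq
    with () ← ≡.trans (≡.sym (splitAt-↑ˡ (suc c) j e))
                      (≡.trans (≡.cong (splitAt (suc c)) eq) (splitAt-↑ʳ (suc c) e p))

  -- coord q l is the coefficient of f_l in f_q.  It is written in the shape of the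
  -- entries of Mhat, so that Mhat i l = Σ_b coord (δ (bas i) b) l x^b.
  coord : State → Fin (suc c) → Carrier
  coord q l = indicator q (bas l) ⊕ sumFin (λ p → α p l ⊗ indicator q (ext p))

  coord-bas : ∀ j l → coord (bas j) l ≈ indicator j l
  coord-bas j l = begin
    indicator (bas j) (bas l) ⊕ sumFin (λ p → α p l ⊗ indicator (bas j) (ext p))
      ≈⟨ +-cong (reflexive (indicator-injective bas (↑ˡ-injective e _ _) j l))
                (sumFin-zero (λ p → trans (*-congˡ (reflexive (indicator-≢ (bas≢ext j p)))) (zeroʳ _))) ⟩
    indicator j l ⊕ 0#  ≈⟨ +-identityʳ _ ⟩
    indicator j l       ∎
    where open SetoidReasoning setoid

  coord-ext : ∀ p l → coord (ext p) l ≈ α p l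
  coord-ext p l = begin
    indicator (ext p) (bas l) ⊕ sumFin (λ q → α q l ⊗ indicator (ext p) (ext q))
      ≈⟨ +-cong (reflexive (indicator-≢ (bas≢ext l p ∘ ≡.sym)))
                (sumFin-cong (λ q →
                  *-congˡ (reflexive (indicator-injective ext (↑ʳ-injective (suc c) _ _) p q)))) ⟩
    0# ⊕ sumFin (λ q → α q l ⊗ indicator p q)  ≈⟨ +-identityˡ _ ⟩
    sumFin (λ q → α q l ⊗ indicator p q)       ≈⟨ sumFin-cong (λ q → *-comm (α q l) (indicator p q)) ⟩
    sumFin (λ q → indicator p q ⊗ α q l)       ≈⟨ sumFin-indicatorˡ p (λ q → α q l) ⟩
    α p l                                      ∎
    where open SetoidReasoning setoid

  wordMatrix : List (Fin k) → Fin (suc c) → Fin (suc c) → Carrier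
  wordMatrix []      = indicator
  wordMatrix (b ∷ w) i j = sumFin (λ l → coord (δ (bas i) b) l ⊗ wordMatrix w l j)

  wordMatrix-[_] : ∀ b i j → wordMatrix (b ∷ []) i j ≈ coord (δ (bas i) b) j
  wordMatrix-[ b ] i j = sumFin-indicatorʳ j (coord (δ (bas i) b))

  wordMatrix-++ : ∀ xs ys i j → wordMatrix (xs ++ ys) i j ≈ sumFin (λ l → wordMatrix xs i l ⊗ wordMatrix ys l j)
  wordMatrix-++ []       ys i j = sym (sumFin-indicatorˡ i (λ l → wordMatrix ys l j))
  wordMatrix-++ (b ∷ xs) ys i j =
    trans (sumFin-cong (λ l → *-congˡ {x = coord (δ (bas i) b) l} (wordMatrix-++ xs ys l j)))
          (sumFin-⊗-assoc (coord (δ (bas i) b)) (wordMatrix xs) (λ m → wordMatrix ys m j))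

  wordMatrix-reverse-∷ : ∀ b xs i j →
    wordMatrix (reverse (b ∷ xs)) i j ≈ sumFin (λ l → wordMatrix (reverse xs) i l ⊗ wordMatrix (b ∷ []) l j)
  wordMatrix-reverse-∷ b xs i j =
    trans (reflexive (≡.cong (λ w → wordMatrix w i j) (unfold-reverse b xs)))
          (wordMatrix-++ (reverse xs) (b ∷ []) i j)

  Mhat-wordSum : ∀ i l → Mhat i l ≈S sumWords 1 (λ w → wordMatrix (toList w) i l ·x^ ⟦ w ⟧)
  Mhat-wordSum i l m = begin
    mM (bas i) (bas l) m ⊕ sumFin (λ p → α p l ⊗ mM (bas i) (ext p) m)
      ≈⟨ +-cong (transitions (bas l)) (sumFin-cong (λ p → *-congˡ (transitions (ext p)))) ⟩
    sumFin (λ b → indicator (δ (bas i) b) (bas l) ⊗ μ b)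
      ⊕ sumFin (λ p → α p l ⊗ sumFin (λ b → indicator (δ (bas i) b) (ext p) ⊗ μ b))
      ≈⟨ sumFin-⊕-linear _ (λ p → α p l) (λ p b → indicator (δ (bas i) b) (ext p)) μ ⟩
    sumFin (λ b → coord (δ (bas i) b) l ⊗ μ b)
      ≈⟨ sumFin-cong (λ b → *-congʳ (wordMatrix-[ b ] i l)) ⟨
    sumFin (λ b → wordMatrix (b ∷ []) i l ⊗ μ b) ∎
    where
      open SetoidReasoning setoid
      μ : Fin k → Carrier
      μ b = mono (toℕ b) m
      transitions : ∀ q → mM (bas i) q m ≈ sumFin (λ b → indicator (δ (bas i) b) q ⊗ μ b)
      transitions q = sumFin-cong (λ b → if-mono (does (δ (bas i) b ≟ q)) (toℕ b) m)

  subS-Mhat : ∀ t i l →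
    subS (k ^ t) (Mhat i l) ≈S sumWords 1 (λ w → wordMatrix (toList w) i l ·x^ (⟦ w ⟧ * k ^ t))
  subS-Mhat t i l = ≈S-trans (subS-cong (k ^ t) (Mhat-wordSum i l))
                             (subS-sumWords-·x^ (k ^ t) (m^n>0 k t) 1 (λ w → wordMatrix (toList w) i l) ⟦_⟧)

  idM-·x^ : ∀ {r} (i j : Fin r) → idM i j ≈S indicator i j ·x^ 0
  idM-·x^ i j m = if-mono (does (i ≟ j)) 0 m

  MhatPow-wordSum : ∀ t i j → MhatPow t i j ≈S sumWords t (λ w → wordMatrix (toList w) i j ·x^ ⟦ w ⟧)
  MhatPow-wordSum zero    i j = idM-·x^ i j
  MhatPow-wordSum (suc t) i j = begin
    sumFinS (λ l → subS (k ^ t) (Mhat i l) *S MhatPow t l j)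
      ≈⟨ sumFinS-cong (λ l → *S-cong (subS-Mhat t i l) (MhatPow-wordSum t l j)) ⟩
    sumFinS (λ l → sumWords 1 (λ b → wordMatrix (toList b) i l ·x^ (⟦ b ⟧ * k ^ t))
                  *S sumWords t (λ v → wordMatrix (toList v) l j ·x^ ⟦ v ⟧))
      ≈⟨ sumFinS-sumWords-*S-sumWords 1 t (λ b l → wordMatrix (toList b) i l) (λ b → ⟦ b ⟧ * k ^ t)
                                    (λ v l → wordMatrix (toList v) l j) ⟦_⟧ ⟩
    sumWords 1 (λ b → sumWords t (λ v →
      sumFin (λ l → wordMatrix (toList b) i l ⊗ wordMatrix (toList v) l j) ·x^ (⟦ b ⟧ * k ^ t + ⟦ v ⟧)))
      ≈⟨ sumWords-cong 1 (λ b → sumWords-cong t (λ v →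
           ·x^-congˡ (⟦ b ⟧ * k ^ t + ⟦ v ⟧) (wordMatrix-++ (toList b) (toList v) i j))) ⟨
    sumWords 1 (λ b → sumWords t (λ v → wordMatrix (toList b ++ toList v) i j ·x^ (⟦ b ⟧ * k ^ t + ⟦ v ⟧)))
      ≈⟨ sumWords-·x^-++ 1 t (λ w → wordMatrix w i j) ⟨
    sumWords (suc t) (λ w → wordMatrix (toList w) i j ·x^ ⟦ w ⟧) ∎
    where open SetoidReasoning ≈S-setoid

  MhatPowR-wordSum : ∀ t i j →
    MhatPowR t i j ≈S sumWords t (λ w → wordMatrix (reverse (toList w)) i j ·x^ ⟦ w ⟧)
  MhatPowR-wordSum zero    i j = idM-·x^ i j
  MhatPowR-wordSum (suc t) i j = begin
    sumFinS (λ l → MhatPowR t i l *S subS (k ^ t) (Mhat l j))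
      ≈⟨ sumFinS-cong (λ l → *S-cong (MhatPowR-wordSum t i l) (subS-Mhat t l j)) ⟩
    sumFinS (λ l → sumWords t (λ v → wordMatrix (reverse (toList v)) i l ·x^ ⟦ v ⟧)
                  *S sumWords 1 (λ b → wordMatrix (toList b) l j ·x^ (⟦ b ⟧ * k ^ t)))
      ≈⟨ sumFinS-sumWords-*S-sumWords t 1 (λ v l → wordMatrix (reverse (toList v)) i l) ⟦_⟧
                                    (λ b l → wordMatrix (toList b) l j) (λ b → ⟦ b ⟧ * k ^ t) ⟩
    sumWords t (λ v → sumWords 1 (λ b → X b v ·x^ (⟦ v ⟧ + ⟦ b ⟧ * k ^ t)))
      ≈⟨ sumWords-comm t 1 (λ v b → X b v ·x^ (⟦ v ⟧ + ⟦ b ⟧ * k ^ t)) ⟩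
    sumWords 1 (λ b → sumWords t (λ v → X b v ·x^ (⟦ v ⟧ + ⟦ b ⟧ * k ^ t)))
      ≈⟨ sumWords-cong 1 (λ b → sumWords-cong t (reversed b)) ⟩
    sumWords 1 (λ b → sumWords t (λ v →
      wordMatrix (reverse (toList b ++ toList v)) i j ·x^ (⟦ b ⟧ * k ^ t + ⟦ v ⟧)))
      ≈⟨ sumWords-·x^-++ 1 t (λ w → wordMatrix (reverse w) i j) ⟨
    sumWords (suc t) (λ w → wordMatrix (reverse (toList w)) i j ·x^ ⟦ w ⟧) ∎
    where
      open SetoidReasoning ≈S-setoid
      X : Word 1 → Word t → Carrier
      X b v = sumFin (λ l → wordMatrix (reverse (toList v)) i l ⊗ wordMatrix (toList b) l j)
      reversed : ∀ b v → X b v ·x^ (⟦ v ⟧ + ⟦ b ⟧ * k ^ t)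
                           ≈S wordMatrix (reverse (toList b ++ toList v)) i j ·x^ (⟦ b ⟧ * k ^ t + ⟦ v ⟧)
      reversed (b ∷ []) v =
        ≈S-trans (·x^-congˡ (⟦ v ⟧ + toℕ b * k ^ t) (sym (wordMatrix-reverse-∷ b (toList v) i j)))
                 (·x^-congʳ _ (ℕ.+-comm ⟦ v ⟧ (toℕ b * k ^ t)))

  module _ (lin : LinRel) where

    f-bas : ∀ j w → f (bas j) w ≈ sumFin (λ l → coord (bas j) l ⊗ f (bas l) w)
    f-bas j w = sym (trans (sumFin-cong (λ l → *-congʳ {x = f (bas l) w} (coord-bas j l)))
                           (sumFin-indicatorˡ j (λ l → f (bas l) w)))

    f-ext : ∀ p w → f (ext p) w ≈ sumFin (λ l → coord (ext p) l ⊗ f (bas l) w)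
    f-ext p w = trans (lin p w) (sym (sumFin-cong (λ l → *-congʳ {x = f (bas l) w} (coord-ext p l))))

    f-coord : ∀ q w → f q w ≈ sumFin (λ l → coord q l ⊗ f (bas l) w)
    f-coord q w with splitAt (suc c) q in eq
    ... | inj₁ j = ≡.subst (λ q → f q w ≈ sumFin (λ l → coord q l ⊗ f (bas l) w))
                           (splitAt⁻¹-↑ˡ eq) (f-bas j w)
    ... | inj₂ p = ≡.subst (λ q → f q w ≈ sumFin (λ l → coord q l ⊗ f (bas l) w))
                           (splitAt⁻¹-↑ʳ eq) (f-ext p w)

    f-++ : ∀ xs ys i → f (bas i) (xs ++ ys) ≈ sumFin (λ j → wordMatrix xs i j ⊗ f (bas j) ys)
    f-++ []       ys i = sym (sumFin-indicatorˡ i (λ j → f (bas j) ys))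
    f-++ (b ∷ xs) ys i =
      trans (f-coord (δ (bas i) b) (xs ++ ys))
            (trans (sumFin-cong (λ l → *-congˡ {x = coord (δ (bas i) b) l} (f-++ xs ys l)))
                   (sumFin-⊗-assoc (coord (δ (bas i) b)) (wordMatrix xs) (λ j → f (bas j) ys)))

    Fhat-scaled : ∀ u t n i → Fhat (u + t) (k ^ u * n) i ≈S (subM (k ^ u) (MhatN t n) ·V Fhat u (k ^ u)) i
    Fhat-scaled u t n i = begin
      Fhat (u + t) (K * n) i
        ≈⟨ truncatedWordSum-split u t n (f (bas i)) ⟩
      sumWords t (λ v → sumWords u (λ w →
        (if ⟦ v ⟧ <ᵇ n then f (bas i) (toList v ++ toList w) else 0#) ·x^ (⟦ v ⟧ * K + ⟦ w ⟧)))
        ≈⟨ sumWords-cong t (λ v → sumWords-cong u (λ w → ·x^-congˡ (⟦ v ⟧ * K + ⟦ w ⟧) (expand v w))) ⟩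
      sumWords t (λ v → sumWords u (λ w →
        sumFin (λ l → P v l ⊗ f (bas l) (toList w)) ·x^ (⟦ v ⟧ * K + ⟦ w ⟧)))
        ≈⟨ sumFinS-sumWords-*S-sumWords t u P (λ v → ⟦ v ⟧ * K) (λ w l → f (bas l) (toList w)) ⟦_⟧ ⟨
      sumFinS (λ l → sumWords t (λ v → P v l ·x^ (⟦ v ⟧ * K))
                    *S sumWords u (λ w → f (bas l) (toList w) ·x^ ⟦ w ⟧))
        ≈⟨ sumFinS-cong (λ l → *S-cong (subS-MhatN l) (Fhat-untruncated l)) ⟨
      (subM K (MhatN t n) ·V Fhat u K) i ∎
      where
        open SetoidReasoning ≈S-setoid
        K : ℕ
        K = k ^ u
        P : Word t → Fin (suc c) → Carrier
        P v l = if ⟦ v ⟧ <ᵇ n then wordMatrix (toList v) i l else 0#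
        expand : ∀ (v : Word t) (w : Word u) →
          (if ⟦ v ⟧ <ᵇ n then f (bas i) (toList v ++ toList w) else 0#)
            ≈ sumFin (λ l → P v l ⊗ f (bas l) (toList w))
        expand v w =
          trans (if-then-cong (⟦ v ⟧ <ᵇ n) (f-++ (toList v) (toList w) i))
                (sym (sumFin-gateˡ (⟦ v ⟧ <ᵇ n) (wordMatrix (toList v) i) (λ l → f (bas l) (toList w))))
        subS-MhatN : ∀ l → subS K (MhatN t n i l) ≈S sumWords t (λ v → P v l ·x^ (⟦ v ⟧ * K))
        subS-MhatN l =
          ≈S-trans (subS-cong K (≈S-trans (trunc-cong n (MhatPow-wordSum t i l))
                                          (trunc-sumWords-·x^ n t (λ v → wordMatrix (toList v) i l) ⟦_⟧)))
                   (subS-sumWords-·x^ K (m^n>0 k u) t (λ v → P v l) ⟦_⟧)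
        Fhat-untruncated : ∀ l → Fhat u K l ≈S sumWords u (λ w → f (bas l) (toList w) ·x^ ⟦ w ⟧)
        Fhat-untruncated l = sumWords-cong u (λ w → ≈S-reflexive
          (≡.cong (λ b → if b then f (bas l) (toList w) ·x^ ⟦ w ⟧ else 0S)
                  (det (<ᵇ-reflects-< _ _) (ofʸ (⟦⟧-< w)))))

    FhatR-scaled : ∀ u t n i →
      FhatR (u + t) (k ^ u * n) i ≈S (MhatPowR u ·V (λ j → subS (k ^ u) (FhatR t n j))) i
    FhatR-scaled u t n i = begin
      FhatR (u + t) (K * n) i
        ≈⟨ truncatedWordSum-split u t n (f (bas i) ∘ reverse) ⟩
      sumWords t (λ v → sumWords u (λ w → X v w ·x^ (⟦ v ⟧ * K + ⟦ w ⟧)))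
        ≈⟨ sumWords-comm t u (λ v w → X v w ·x^ (⟦ v ⟧ * K + ⟦ w ⟧)) ⟩
      sumWords u (λ w → sumWords t (λ v → X v w ·x^ (⟦ v ⟧ * K + ⟦ w ⟧)))
        ≈⟨ sumWords-cong u (λ w → sumWords-cong t (expand w)) ⟩
      sumWords u (λ w → sumWords t (λ v → sumFin (λ l → W w l ⊗ Q v l) ·x^ (⟦ w ⟧ + ⟦ v ⟧ * K)))
        ≈⟨ sumFinS-sumWords-*S-sumWords u t W ⟦_⟧ Q (λ v → ⟦ v ⟧ * K) ⟨
      sumFinS (λ l → sumWords u (λ w → W w l ·x^ ⟦ w ⟧)
                    *S sumWords t (λ v → Q v l ·x^ (⟦ v ⟧ * K)))
        ≈⟨ sumFinS-cong (λ l → *S-cong (MhatPowR-wordSum u i l) (subS-FhatR l)) ⟨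
      (MhatPowR u ·V (λ j → subS K (FhatR t n j))) i ∎
      where
        open SetoidReasoning ≈S-setoid
        K : ℕ
        K = k ^ u
        X : Word t → Word u → Carrier
        X v w = if ⟦ v ⟧ <ᵇ n then f (bas i) (reverse (toList v ++ toList w)) else 0#
        Q : Word t → Fin (suc c) → Carrier
        Q v l = if ⟦ v ⟧ <ᵇ n then f (bas l) (reverse (toList v)) else 0#
        W : Word u → Fin (suc c) → Carrier
        W w l = wordMatrix (reverse (toList w)) i l
        coefficient : ∀ (w : Word u) (v : Word t) → X v w ≈ sumFin (λ l → W w l ⊗ Q v l)
        coefficient w v =
          trans (if-then-cong (⟦ v ⟧ <ᵇ n)
                  (trans (reflexive (≡.cong (f (bas i)) (reverse-++ (toList v) (toList w))))
                         (f-++ (reverse (toList w)) (reverse (toList v)) i)))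
                (sym (sumFin-gateʳ (⟦ v ⟧ <ᵇ n) (W w) (λ l → f (bas l) (reverse (toList v)))))
        expand : ∀ (w : Word u) (v : Word t) →
          X v w ·x^ (⟦ v ⟧ * K + ⟦ w ⟧) ≈S sumFin (λ l → W w l ⊗ Q v l) ·x^ (⟦ w ⟧ + ⟦ v ⟧ * K)
        expand w v = ≈S-trans (·x^-congˡ _ (coefficient w v)) (·x^-congʳ _ (ℕ.+-comm (⟦ v ⟧ * K) ⟦ w ⟧))
        subS-FhatR : ∀ l → subS K (FhatR t n l) ≈S sumWords t (λ v → Q v l ·x^ (⟦ v ⟧ * K))
        subS-FhatR l = ≈S-trans (subS-cong K (sumWords-cong t (λ v → if-·x^ (⟦ v ⟧ <ᵇ n) _ _)))
                                (subS-sumWords-·x^ K (m^n>0 k u) t (λ v → Q v l) ⟦_⟧)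

proposition5p1 : ∀ {a ℓ} (R : CommutativeRing a ℓ) (k : ℕ) → 2 ≤ k →
    (c e : ℕ) (δ : Fin (suc c + e) → Fin k → Fin (suc c + e))
    (τ : Fin (suc c + e) → CommutativeRing.Carrier R)
    (α : Fin e → Fin (suc c) → CommutativeRing.Carrier R) →
    Automaton.LinRel R k δ τ α →
    (u n t : ℕ) → 1 ≤ u → 1 ≤ n → LenFor k n t →
    let open Series R
        open Automaton R k δ τ α
    in (∀ i → Fhat (u + t) (k ^ u * n) i ≈S (subM (k ^ u) (MhatN t n) ·V Fhat u (k ^ u)) i)
       × (∀ i → FhatR (u + t) (k ^ u * n) i ≈S (MhatPowR u ·V (λ j → subS (k ^ u) (FhatR t n j))) i)
proposition5p1 R k 2≤k c e δ τ α lin u n t _ _ _ = Fhat-scaled lin u t n , FhatR-scaled lin u t n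
  where
    -- Both identities hold for all u, n and t: the side conditions only single out the t
    -- meant in the paper, and k ≥ 2 is used only through k ≠ 0.
    instance
      k≢0 : NonZero k
      k≢0 = >-nonZero (≤-trans (s≤s z≤n) 2≤k)
    open AutomatonSeries R δ τ α
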